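{- Let a finite group $\Gamma$ act on a finite set $X$, and consider a run of the Construction described below which performs $k-1$ iterations, producing the labelling $\phi:X\to\{1,\dots,k\}$, groups $\Gamma_1\supseteq\cdots\supseteq\Gamma_k$ and sets $X_1\supseteq\cdots\supseteq X_k$. Let $2\le j\le k$ and let $y_1,\dots,y_j\in X$ satisfy (1) $\phi(y_i)=i$ for each $i$, and (2) $y_{i+1}\in\Gamma_{i-1}.y_i$ for each $i$ from $2$ to $j-1$, and $y_1\in\Gamma_{j-1}.y_j$. Then $$|\Gamma|\ \ge\ |\Gamma_1.y_2|\,|\Gamma_2.y_3|\cdots|\Gamma_{j-1}.y_j|\,|\Gamma_j.y_1|\,|\mathrm{Stab}_{\Gamma_j}(y_1)|.$$
   Context: For a group $H$ acting on a set $Y$, write $h.y$ for the action, $H.y$ for the orbit, and $\mathrm{Stab}_H(Z)=\{h\in H: h.z=z \text{ for all } z\in Z\}$ (with $\mathrm{Stab}_H(y)=\mathrm{Stab}_H(\{y\})$). Construction: (1) Set $i=1$, $\phi(x)=1$ for all $x\in X$, $\Gamma_1=\Gamma$, $X_1=X$. (2) While some element of $\Gamma_i$ moves some element of $X_i$: (a) choose a subset $X'_{i+1}\subseteq X_i$ containing exactly one element from each $\Gamma_i$-orbit in $X_i$ having at least two elements (and no other elements); (b) set $\phi(x)=i+1$ for each $x\in X'_{i+1}$; (c) set $X_{i+1}=X_i\setminus X'_{i+1}$ and $\Gamma_{i+1}=\mathrm{Stab}_{\Gamma_i}(X'_{i+1})$; (d) increase $i$ by $1$. -}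

module Defs where

open import Data.Nat using (ℕ; zero; suc; _+_; _*_; _∸_; _≤_; _<_)
open import Data.Fin using (Fin)
open import Data.Fin.Properties using (any?; _≟_)
open import Data.Fin.Subset using (Subset; _∈_; _∉_; ∣_∣)
open import Data.Fin.Subset.Properties using (_∈?_)
open import Data.Vec using (tabulate)
open import Data.Product using (Σ; ∃; _×_; _,_)
open import Relation.Nullary using (¬_; does)
open import Relation.Nullary.Decidable using (_×-dec_)
open import Relation.Binary.PropositionalEquality using (_≡_; _≢_)
open import Algebra.Core using (Op₁; Op₂)
open import Algebra.Structures using (IsGroup)
open import Function.Bundles using (_⇔_)

-- A finite group, presented (up to isomorphism) on the carrier Fin order,
-- with propositional equality.
record FinGroup : Set where
  field
    order   : ℕ
    _∙_     : Op₂ (Fin order)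
    ε       : Fin order
    _⁻¹     : Op₁ (Fin order)
    isGroup : IsGroup _≡_ _∙_ ε _⁻¹

record Action (G : FinGroup) (m : ℕ) : Set where
  open FinGroup G
  field
    act     : Fin order → Fin m → Fin m
    act-ε   : ∀ x → act ε x ≡ x
    act-∙   : ∀ g h x → act (g ∙ h) x ≡ act g (act h x)

module _ {G : FinGroup} {m : ℕ} (A : Action G m) where
  open FinGroup G
  open Action A

  orbit : Subset order → Fin m → Subset m
  orbit H x = tabulate (λ y → does (any? (λ h → (h ∈? H) ×-dec (act h x ≟ y))))

  stab : Subset order → Fin m → Subset order
  stab H y = tabulate (λ h → does ((h ∈? H) ×-dec (act h y ≟ y)))

prodFrom : ℕ → ℕ → (ℕ → ℕ) → ℕ
prodFrom lo zero    f = 1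
prodFrom lo (suc n) f = f lo * prodFrom (suc lo) n f

-- Indices are 1-based: Γs i, Xs i for 1 ≤ i ≤ k, and X's (i+1) is the set
-- X'_{i+1} chosen in iteration i (1 ≤ i ≤ k - 1).  Values at other indices
-- are irrelevant.
record Run {G : FinGroup} {m : ℕ} (A : Action G m) (k : ℕ) : Set where
  open FinGroup G
  open Action A
  field
    Γs  : ℕ → Subset order
    Xs  : ℕ → Subset m
    X's : ℕ → Subset m
    φ   : Fin m → ℕ
    1≤k : 1 ≤ k
    Γ₁-all : ∀ g → g ∈ Γs 1
    X₁-all : ∀ x → x ∈ Xs 1
    -- (2) for iterations i = 1, …, k-1: loop condition holds
    moves : ∀ i → 1 ≤ i → i < k →
      ∃ λ g → ∃ λ x → g ∈ Γs i × x ∈ Xs i × act g x ≢ x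
    X'-sub : ∀ i → 1 ≤ i → i < k → ∀ z → z ∈ X's (suc i) →
      z ∈ Xs i × 2 ≤ ∣ orbit A (Γs i) z ∣
    X'-meets : ∀ i → 1 ≤ i → i < k → ∀ x → x ∈ Xs i →
      2 ≤ ∣ orbit A (Γs i) x ∣ → ∃ λ z → z ∈ X's (suc i) × z ∈ orbit A (Γs i) x
    X'-unique : ∀ i → 1 ≤ i → i < k → ∀ z z' → z ∈ X's (suc i) →
      z' ∈ X's (suc i) → z' ∈ orbit A (Γs i) z → z ≡ z'
    X-step : ∀ i → 1 ≤ i → i < k → ∀ x →
      (x ∈ Xs (suc i)) ⇔ (x ∈ Xs i × x ∉ X's (suc i))
    Γ-step : ∀ i → 1 ≤ i → i < k → ∀ g →
      (g ∈ Γs (suc i)) ⇔ (g ∈ Γs i × (∀ z → z ∈ X's (suc i) → act g z ≡ z))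
    φ-step : ∀ i → 1 ≤ i → i < k → ∀ x → x ∈ X's (suc i) → φ x ≡ suc i
    φ-rest : ∀ x → (∀ i → 1 ≤ i → i < k → x ∉ X's (suc i)) → φ x ≡ 1
    -- the loop stops after k - 1 iterations
    stops : ∀ g x → g ∈ Γs k → x ∈ Xs k → act g x ≡ x

-- Write f(i) = |Γ_i.y_{i+1}|.  Since φ(y_{i+1}) = i+1, the point y_{i+1} lies in
-- X'_{i+1}, so Γ_{i+1} ⊆ Stab_{Γ_i}(y_{i+1}) and the orbit–stabiliser inequality
-- gives f(i) |Γ_{i+1}| ≤ |Γ_i|.  These telescope to f(1) ⋯ f(j-1) |Γ_j| ≤ |Γ_1| = |Γ|,
-- and one more orbit–stabiliser step, for Γ_j at y_1, bounds |Γ_j| from below by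
-- the last two factors.
module Submission where

open import Defs
open import Data.Nat using (ℕ; zero; suc; _+_; _*_; _∸_; _≤_; _<_; z≤n; s≤s)
open import Data.Nat.Properties
  using ( ≤-refl; ≤-reflexive; ≤-trans; <⇒≤; >⇒≢; m<m+n; suc-injective
        ; +-identityʳ; +-suc; *-assoc; +-mono-≤; *-monoʳ-≤; +-*-semiring; module ≤-Reasoning)
open import Data.Bool using (Bool; true; false)
open import Data.Fin as Fin using (Fin)
open import Data.Fin.Properties using (any?; _≟_)
open import Data.Fin.Subset using (Subset; _∈_; _∉_; _⊆_; ∣_∣; ⁅_⁆; ⊥)
open import Data.Fin.Subset.Properties
  using (_∈?_; ∣p∣≤n; p⊆q⇒∣p∣≤∣q∣; ∣⁅x⁆∣≡1; ∣⊥∣≡0; x∈⁅x⁆)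
open import Data.Fin.Permutation using (Permutation′; permutation; _⟨$⟩ʳ_)
open import Data.Vec using ([]; _∷_; lookup; tabulate)
open import Data.Vec.Properties using ([]=⇒lookup; lookup⇒[]=; lookup∘tabulate)
open import Data.Product using (∃; _×_; _,_)
open import Function using (_∘_)
open import Function.Bundles using (_⇔_; Equivalence)
open import Relation.Unary using (Pred; Decidable)
open import Relation.Nullary using (yes; does)
open import Relation.Nullary.Decidable using (_×-dec_; dec-true; decidable-stable)
open import Relation.Binary.PropositionalEquality
open import Algebra.Structures using (IsGroup)
open import Algebra.Properties.Semiring.Sum +-*-semiring
  using (sum; sum-syntax; ∑-comm; ∑-permute; sum-cong-≗; *-distribʳ-sum)

private
  variable
    m n : ℕ

∈tabulate⇒ : ∀ (g : Fin n → Bool) {i} → i ∈ tabulate g → g i ≡ true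
∈tabulate⇒ g {i} i∈ = trans (sym (lookup∘tabulate g i)) ([]=⇒lookup i∈)

module _ {ℓ} {P : Pred (Fin n) ℓ} (P? : Decidable P) where

  ∈-tabulate⁻ : ∀ {i} → i ∈ tabulate (λ j → does (P? j)) → P i
  ∈-tabulate⁻ {i} i∈ with P? i | ∈tabulate⇒ (λ j → does (P? j)) i∈
  ... | yes p | _ = p

  ∈-tabulate⁺ : ∀ {i} → P i → i ∈ tabulate (λ j → does (P? j))
  ∈-tabulate⁺ {i} p = lookup⇒[]= i _ (trans (lookup∘tabulate _ i) (dec-true (P? i) p))

𝟙 : Bool → ℕ
𝟙 true  = 1
𝟙 false = 0

∣p∣≡∑𝟙 : (p : Subset n) → ∣ p ∣ ≡ ∑[ i < n ] 𝟙 (lookup p i)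
∣p∣≡∑𝟙 []          = refl
∣p∣≡∑𝟙 (true ∷ p)  = cong suc (∣p∣≡∑𝟙 p)
∣p∣≡∑𝟙 (false ∷ p) = ∣p∣≡∑𝟙 p

∣tabulate∣≡∑𝟙 : (g : Fin n → Bool) → ∣ tabulate g ∣ ≡ ∑[ i < n ] 𝟙 (g i)
∣tabulate∣≡∑𝟙 g = trans (∣p∣≡∑𝟙 (tabulate g)) (sum-cong-≗ (cong 𝟙 ∘ lookup∘tabulate g))

∑-mono-≤ : {f g : Fin n → ℕ} → (∀ i → f i ≤ g i) → sum f ≤ sum g
∑-mono-≤ {zero}  f≤g = z≤n
∑-mono-≤ {suc n} f≤g = +-mono-≤ (f≤g Fin.zero) (∑-mono-≤ (f≤g ∘ Fin.suc))

𝟙-mono-∈ : ∀ {p : Subset m} {q : Subset n} {i j} →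
           (i ∈ p → j ∈ q) → 𝟙 (lookup p i) ≤ 𝟙 (lookup q j)
𝟙-mono-∈ {p = p} {q} {i} {j} i∈p⇒j∈q with lookup p i in eq
... | false = z≤n
... | true rewrite []=⇒lookup (i∈p⇒j∈q (lookup⇒[]= i p eq)) = ≤-refl

∣p∣≤∣q∣-permute : (π : Permutation′ n) {p q : Subset n} →
                  (∀ {i} → i ∈ p → π ⟨$⟩ʳ i ∈ q) → ∣ p ∣ ≤ ∣ q ∣
∣p∣≤∣q∣-permute {n} π {p} {q} πp⊆q = begin
  ∣ p ∣                               ≡⟨ ∣p∣≡∑𝟙 p ⟩
  ∑[ i < n ] 𝟙 (lookup p i)           ≤⟨ ∑-mono-≤ (λ i → 𝟙-mono-∈ {i = i} πp⊆q) ⟩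
  ∑[ i < n ] 𝟙 (lookup q (π ⟨$⟩ʳ i))  ≡⟨ ∑-permute (𝟙 ∘ lookup q) π ⟨
  ∑[ i < n ] 𝟙 (lookup q i)           ≡⟨ ∣p∣≡∑𝟙 q ⟨
  ∣ q ∣                               ∎
  where open ≤-Reasoning

∣p∣*c≤∑ : (p : Subset n) {c : ℕ} (w : Fin n → ℕ) →
          (∀ {i} → i ∈ p → c ≤ w i) → ∣ p ∣ * c ≤ ∑[ i < n ] w i
∣p∣*c≤∑ {n} p {c} w c≤w = begin
  ∣ p ∣ * c                          ≡⟨ cong (_* c) (∣p∣≡∑𝟙 p) ⟩
  (∑[ i < n ] 𝟙 (lookup p i)) * c    ≡⟨ *-distribʳ-sum c (𝟙 ∘ lookup p) ⟩
  ∑[ i < n ] (𝟙 (lookup p i) * c)    ≤⟨ ∑-mono-≤ term≤w ⟩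
  ∑[ i < n ] w i                     ∎
  where
  open ≤-Reasoning
  term≤w : ∀ i → 𝟙 (lookup p i) * c ≤ w i
  term≤w i with lookup p i in eq
  ... | false = z≤n
  ... | true  = ≤-trans (≤-reflexive (+-identityʳ c)) (c≤w (lookup⇒[]= i p eq))

∑∣fibre∣≤∣p∣ : (F : Fin m → Subset n) (p : Subset n) (f : Fin n → Fin m) →
               (∀ {y i} → i ∈ F y → i ∈ p × f i ≡ y) → ∑[ y < m ] ∣ F y ∣ ≤ ∣ p ∣
∑∣fibre∣≤∣p∣ {m} {n} F p f F⊆p∩f⁻¹ = begin
  ∑[ y < m ] ∣ F y ∣                        ≡⟨ sum-cong-≗ (∣p∣≡∑𝟙 ∘ F) ⟩
  ∑[ y < m ] ∑[ i < n ] 𝟙 (lookup (F y) i)  ≡⟨ ∑-comm (λ y i → 𝟙 (lookup (F y) i)) ⟩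
  ∑[ i < n ] ∑[ y < m ] 𝟙 (lookup (F y) i)  ≡⟨ sum-cong-≗ (∣tabulate∣≡∑𝟙 ∘ column) ⟨
  ∑[ i < n ] ∣ tabulate (column i) ∣        ≤⟨ ∑-mono-≤ ∣column∣≤𝟙 ⟩
  ∑[ i < n ] 𝟙 (lookup p i)                 ≡⟨ ∣p∣≡∑𝟙 p ⟨
  ∣ p ∣                                     ∎
  where
  open ≤-Reasoning
  column : Fin n → Fin m → Bool
  column i y = lookup (F y) i

  in-column : ∀ {i y} → y ∈ tabulate (column i) → i ∈ p × f i ≡ y
  in-column {i} {y} y∈ = F⊆p∩f⁻¹ (lookup⇒[]= i (F y) (∈tabulate⇒ (column i) y∈))

  ∣column∣≤𝟙 : ∀ i → ∣ tabulate (column i) ∣ ≤ 𝟙 (lookup p i)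
  ∣column∣≤𝟙 i with lookup p i in eq
  ... | true  = ≤-trans (p⊆q⇒∣p∣≤∣q∣ at-most-f-i) (≤-reflexive (∣⁅x⁆∣≡1 (f i)))
    where
    at-most-f-i : tabulate (column i) ⊆ ⁅ f i ⁆
    at-most-f-i y∈ with in-column y∈
    ... | _ , refl = x∈⁅x⁆ (f i)
  ... | false = ≤-trans (p⊆q⇒∣p∣≤∣q∣ empty) (≤-reflexive (∣⊥∣≡0 m))
    where
    empty : tabulate (column i) ⊆ ⊥
    empty y∈ with in-column y∈
    ... | i∈p , _ with () ← trans (sym eq) ([]=⇒lookup i∈p)

module OrbitStabiliser {G : FinGroup} {m : ℕ} (A : Action G m) where
  open FinGroup G
  open Action A
  open IsGroup isGroup using (assoc; identityˡ; inverseˡ; inverseʳ)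
  open Equivalence using (to; from)

  Closed : Subset order → Set
  Closed H = ∀ {g h} → g ∈ H → h ∈ H → g ∙ h ∈ H

  Closed-pointwiseStab : ∀ {H K : Subset order} {Z : Subset m} → Closed H →
                  (∀ g → g ∈ K ⇔ (g ∈ H × (∀ z → z ∈ Z → act g z ≡ z))) → Closed K
  Closed-pointwiseStab {Z = Z} closed K⇔ {g} {h} g∈K h∈K with to (K⇔ g) g∈K | to (K⇔ h) h∈K
  ... | g∈H , g-fixes | h∈H , h-fixes = from (K⇔ (g ∙ h)) (closed g∈H h∈H , gh-fixes)
    where
    gh-fixes : ∀ z → z ∈ Z → act (g ∙ h) z ≡ z
    gh-fixes z z∈ = trans (act-∙ g h z) (trans (cong (act g) (h-fixes z z∈)) (g-fixes z z∈))

  translation : Fin order → Permutation′ order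
  translation g = permutation (g ∙_) ((g ⁻¹) ∙_) cancel⁻¹ cancel
    where
    cancel⁻¹ : ∀ h → g ∙ ((g ⁻¹) ∙ h) ≡ h
    cancel⁻¹ h = trans (sym (assoc g (g ⁻¹) h)) (trans (cong (_∙ h) (inverseʳ g)) (identityˡ h))
    cancel : ∀ h → (g ⁻¹) ∙ (g ∙ h) ≡ h
    cancel h = trans (sym (assoc (g ⁻¹) g h)) (trans (cong (_∙ h) (inverseˡ g)) (identityˡ h))

  fibre : Subset order → Fin m → Fin m → Subset order
  fibre H x y = tabulate (λ h → does ((h ∈? H) ×-dec (act h x ≟ y)))

  ∈orbit⁻ : ∀ {H x y} → y ∈ orbit A H x → ∃ λ h → h ∈ H × act h x ≡ y
  ∈orbit⁻ {H} {x} = ∈-tabulate⁻ (λ y → any? (λ h → (h ∈? H) ×-dec (act h x ≟ y)))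

  ∈stab⁻ : ∀ {H x h} → h ∈ stab A H x → h ∈ H × act h x ≡ x
  ∈stab⁻ {H} {x} = ∈-tabulate⁻ (λ h → (h ∈? H) ×-dec (act h x ≟ x))

  ∈stab⁺ : ∀ {H x h} → h ∈ H → act h x ≡ x → h ∈ stab A H x
  ∈stab⁺ {H} {x} h∈H hx≡x = ∈-tabulate⁺ (λ h → (h ∈? H) ×-dec (act h x ≟ x)) (h∈H , hx≡x)

  ∈fibre⁻ : ∀ {H x y h} → h ∈ fibre H x y → h ∈ H × act h x ≡ y
  ∈fibre⁻ {H} {x} {y} = ∈-tabulate⁻ (λ h → (h ∈? H) ×-dec (act h x ≟ y))

  -- Left translation by any g ∈ H with g.x = y maps Stab_H(x) into the fibre
  -- over y; closure of H under ∙ is all that is needed for this.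
  ∣stab∣≤∣fibre∣ : ∀ {H x y} → Closed H → y ∈ orbit A H x → ∣ stab A H x ∣ ≤ ∣ fibre H x y ∣
  ∣stab∣≤∣fibre∣ {H} {x} {y} closed y∈Hx with ∈orbit⁻ y∈Hx
  ... | g , g∈H , gx≡y = ∣p∣≤∣q∣-permute (translation g) translate
    where
    translate : ∀ {s} → s ∈ stab A H x → g ∙ s ∈ fibre H x y
    translate {s} s∈stab with ∈stab⁻ s∈stab
    ... | s∈H , sx≡x = ∈-tabulate⁺ (λ h → (h ∈? H) ×-dec (act h x ≟ y)) (closed g∈H s∈H , gs-x≡y)
      where
      gs-x≡y : act (g ∙ s) x ≡ y
      gs-x≡y = begin
        act (g ∙ s) x   ≡⟨ act-∙ g s x ⟩
        act g (act s x) ≡⟨ cong (act g) sx≡x ⟩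
        act g x         ≡⟨ gx≡y ⟩
        y               ∎
        where open ≡-Reasoning

  ∣orbit∣*∣stab∣≤∣H∣ : ∀ {H} → Closed H → ∀ x → ∣ orbit A H x ∣ * ∣ stab A H x ∣ ≤ ∣ H ∣
  ∣orbit∣*∣stab∣≤∣H∣ {H} closed x =
    ≤-trans (∣p∣*c≤∑ (orbit A H x) (∣_∣ ∘ fibre H x) (∣stab∣≤∣fibre∣ closed))
            (∑∣fibre∣≤∣p∣ (fibre H x) H (λ h → act h x) ∈fibre⁻)

prodFrom-telescope : ∀ (f g : ℕ → ℕ) lo n →
                     (∀ i → lo ≤ i → i < lo + n → f i * g (suc i) ≤ g i) →
                     prodFrom lo n f * g (lo + n) ≤ g lo
prodFrom-telescope f g lo zero    _    rewrite +-identityʳ lo = ≤-reflexive (+-identityʳ (g lo))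
prodFrom-telescope f g lo (suc n) step = begin
  f lo * prodFrom (suc lo) n f * g (lo + suc n)
    ≡⟨ cong (λ t → f lo * prodFrom (suc lo) n f * g t) (+-suc lo n) ⟩
  f lo * prodFrom (suc lo) n f * g (suc lo + n)
    ≡⟨ *-assoc (f lo) _ _ ⟩
  f lo * (prodFrom (suc lo) n f * g (suc lo + n))
    ≤⟨ *-monoʳ-≤ (f lo) (prodFrom-telescope f g (suc lo) n step′) ⟩
  f lo * g (suc lo)
    ≤⟨ step lo ≤-refl (m<m+n lo (s≤s z≤n)) ⟩
  g lo ∎
  where
  open ≤-Reasoning
  step′ : ∀ i → suc lo ≤ i → i < suc lo + n → f i * g (suc i) ≤ g i
  step′ i 1+lo≤i i<1+lo+n =
    step i (<⇒≤ 1+lo≤i) (≤-trans i<1+lo+n (≤-reflexive (sym (+-suc lo n))))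

module _ {G : FinGroup} {m k : ℕ} {A : Action G m} (R : Run A k) where
  open FinGroup G
  open Action A
  open Run R
  open OrbitStabiliser A
  open Equivalence using (to)

  Γ-closed : ∀ {i} → 1 ≤ i → i ≤ k → Closed (Γs i)
  Γ-closed {suc zero}    _ _     _ _ = Γ₁-all _
  Γ-closed {suc (suc i)} _ 2+i≤k =
    Closed-pointwiseStab (Γ-closed {suc i} (s≤s z≤n) (<⇒≤ 2+i≤k)) (Γ-step (suc i) (s≤s z≤n) 2+i≤k)

  -- φ x = i + 1 with i ≥ 1 cannot come from the default label 1, so x was
  -- labelled in iteration i; membership in X'_{i+1} is decidable, hence stable.
  φ≡1+i⇒∈X′ : ∀ {i x} → 1 ≤ i → i < k → φ x ≡ suc i → x ∈ X's (suc i)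
  φ≡1+i⇒∈X′ {i} {x} 1≤i _ φx≡1+i = decidable-stable (x ∈? X's (suc i)) λ x∉X′ →
    >⇒≢ 1≤i (suc-injective (trans (sym φx≡1+i) (φ-rest x (unlabelled x∉X′))))
    where
    unlabelled : x ∉ X's (suc i) → ∀ i′ → 1 ≤ i′ → i′ < k → x ∉ X's (suc i′)
    unlabelled x∉X′ i′ 1≤i′ i′<k x∈X′ =
      x∉X′ (subst (λ t → x ∈ X's t) (trans (sym (φ-step i′ 1≤i′ i′<k x x∈X′)) φx≡1+i) x∈X′)

  Γ₊⊆stab : ∀ {i x} → 1 ≤ i → i < k → x ∈ X's (suc i) → Γs (suc i) ⊆ stab A (Γs i) x
  Γ₊⊆stab {i} {x} 1≤i i<k x∈X′ {g} g∈ with to (Γ-step i 1≤i i<k g) g∈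
  ... | g∈Γ , g-fixes = ∈stab⁺ g∈Γ (g-fixes x x∈X′)

  ∣orbit∣*∣Γ₊∣≤∣Γ∣ : ∀ {i x} → 1 ≤ i → i < k → x ∈ X's (suc i) →
                     ∣ orbit A (Γs i) x ∣ * ∣ Γs (suc i) ∣ ≤ ∣ Γs i ∣
  ∣orbit∣*∣Γ₊∣≤∣Γ∣ {i} {x} 1≤i i<k x∈X′ =
    ≤-trans (*-monoʳ-≤ ∣ orbit A (Γs i) x ∣ (p⊆q⇒∣p∣≤∣q∣ (Γ₊⊆stab 1≤i i<k x∈X′)))
            (∣orbit∣*∣stab∣≤∣H∣ (Γ-closed 1≤i (<⇒≤ i<k)) x)

theorem2p10 : (G : FinGroup) (m : ℕ) (A : Action G m) (k : ℕ) (R : Run A k)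
    (j : ℕ) → 2 ≤ j → j ≤ k → (y : ℕ → Fin m)
    → (∀ i → 1 ≤ i → i ≤ j → Run.φ R (y i) ≡ i)
    → (∀ i → 2 ≤ i → i ≤ j ∸ 1 → y (suc i) ∈ orbit A (Run.Γs R (i ∸ 1)) (y i))
    → y 1 ∈ orbit A (Run.Γs R (j ∸ 1)) (y j)
    → prodFrom 1 (j ∸ 1) (λ i → ∣ orbit A (Run.Γs R i) (y (suc i)) ∣)
        * ∣ orbit A (Run.Γs R j) (y 1) ∣
        * ∣ stab A (Run.Γs R j) (y 1) ∣
      ≤ FinGroup.order G
theorem2p10 G m A k R (suc j) (s≤s _) 1+j≤k y φyᵢ≡i _ _ = begin
  P * ∣ orbit A (Γs (suc j)) (y 1) ∣ * ∣ stab A (Γs (suc j)) (y 1) ∣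
    ≡⟨ *-assoc P _ _ ⟩
  P * (∣ orbit A (Γs (suc j)) (y 1) ∣ * ∣ stab A (Γs (suc j)) (y 1) ∣)
    ≤⟨ *-monoʳ-≤ P (∣orbit∣*∣stab∣≤∣H∣ A (Γ-closed R (s≤s z≤n) 1+j≤k) (y 1)) ⟩
  P * ∣ Γs (1 + j) ∣
    ≤⟨ prodFrom-telescope _ (λ i → ∣ Γs i ∣) 1 j step ⟩
  ∣ Γs 1 ∣
    ≤⟨ ∣p∣≤n (Γs 1) ⟩
  FinGroup.order G ∎
  where
  open ≤-Reasoning
  open Run R
  open OrbitStabiliser using (∣orbit∣*∣stab∣≤∣H∣)
  P : ℕ
  P = prodFrom 1 j (λ i → ∣ orbit A (Γs i) (y (suc i)) ∣)
  step : ∀ i → 1 ≤ i → i < 1 + j → ∣ orbit A (Γs i) (y (suc i)) ∣ * ∣ Γs (suc i) ∣ ≤ ∣ Γs i ∣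
  step i 1≤i i<1+j =
    ∣orbit∣*∣Γ₊∣≤∣Γ∣ R 1≤i i<k (φ≡1+i⇒∈X′ R 1≤i i<k (φyᵢ≡i (suc i) (s≤s z≤n) i<1+j))
    where
    i<k : i < k
    i<k = ≤-trans i<1+j 1+j≤k
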